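{- Let $T\subseteq\mathfrak{S}_n$ be invariant under the modified Foata–Strehl action. Then $\Psi'$ restricts to a bijection $T\to T$ and $\operatorname{veh}(\pi)=\operatorname{des}(\Psi'(\pi))$ for all $\pi\in T$.
   Context: For $\pi=a_1\cdots a_n\in\mathfrak{S}_n$ set $a_0=a_{n+1}=n+1$; a letter $a_k$ is a valley, peak, double ascent or double descent according as $a_{k-1}>a_k<a_{k+1}$, $a_{k-1}<a_k>a_{k+1}$, $a_{k-1}<a_k<a_{k+1}$, $a_{k-1}>a_k>a_{k+1}$. For $x\in[n]$ write $\pi=w_1w_2xw_4w_5$ where $w_2$ (resp. $w_4$) is the maximal contiguous subword immediately left (resp. right) of $x$ all of whose letters are smaller than $x$; $\varphi_x(\pi)=w_1w_4xw_2w_5$; $\varphi'_x(\pi)=\varphi_x(\pi)$ if $x$ is a double ascent or double descent and $\varphi'_x(\pi)=\pi$ otherwise. These commute and are involutions; $\mathbb{Z}_2^n$ acts via $\varphi'_S=\prod_{x\in S}\varphi'_x$ (modified Foata–Strehl action), and $T$ is invariant if $\varphi'_S(T)\subseteq T$ for all $S$. The decreasing binary tree of a word $w$: empty word gives empty tree; else $w=LmR$ with $m$ maximal, root $m$, left subtree from $L$, right subtree from $R$. Let $r_\pi(x)$ be the number of right edges on the path from the root to $x$ in the decreasing binary tree of $\pi$, $\operatorname{Odd}(\pi)=\{x:r_\pi(x)\text{ odd}\}$, and $\Psi'(\pi)=\prod_{x\in\operatorname{Odd}(\pi)}\varphi'_x(\pi)$. $\operatorname{des}(\pi)=|\{i\in[n-1]:a_i>a_{i+1}\}|$.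 The unordered decreasing tree $T(w;m)$ of a word $w$ with distinct letters less than $m$: if $w$ is empty it is a single vertex labeled $m$; otherwise write $w=m_1w_1m_2w_2\cdots m_kw_k$ with $m_1,\dots,m_k$ the left-to-right maxima of $w$, and $T(w;m)$ has root $m$ with subtrees $T(w_1;m_1),\dots,T(w_k;m_k)$. With $\infty$ a symbol larger than all letters, $\operatorname{veh}(\pi)$ is the number of non-root vertices of $T(\pi;\infty)$ at even distance from the root. -}

module Defs where

open import Data.Nat using (ℕ; zero; suc; _+_; _≤_; _<ᵇ_; _≡ᵇ_; _⊔_)
open import Data.Nat.Properties using ()
import Data.Bool
open import Data.Bool using (Bool; true; false; if_then_else_; _∧_; _∨_; not)
open import Data.List using (List; []; _∷_; _++_; reverse; takeWhile; dropWhile; length; map; foldr; sum; filter; upTo)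
open import Data.Bool.ListAction using (any)
open import Data.List.Relation.Unary.All using (All)
open import Data.List.Relation.Unary.Unique.Propositional using (Unique)
open import Data.List.Relation.Binary.Permutation.Propositional using (_↭_)
open import Data.Maybe using (Maybe; just; nothing)
open import Data.Product using (_×_; _,_; proj₁; proj₂)
open import Relation.Nullary.Decidable using (⌊_⌋)
open import Data.Nat using (_<?_)

-- Permutations of [n] = {1,…,n} in one-line notation, as lists of ℕ.

oneTo : ℕ → List ℕ
oneTo n = map suc (upTo n)

IsPerm : ℕ → List ℕ → Set
IsPerm n w = w ↭ oneTo n

splitAtLetter : ℕ → List ℕ → Maybe (List ℕ × List ℕ)
splitAtLetter x [] = nothing
splitAtLetter x (a ∷ w) with x ≡ᵇ a
... | true = just ([] , w)
... | false with splitAtLetter x w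
...   | nothing = nothing
...   | just (u , v) = just (a ∷ u , v)

smaller : ℕ → ℕ → Bool
smaller x a = a <ᵇ x

φ : ℕ → List ℕ → List ℕ
φ x π with splitAtLetter x π
... | nothing = π
... | just (u , v) =
  let w₂ = reverse (takeWhile (λ a → a <? x) (reverse u))
      w₁ = reverse (dropWhile (λ a → a <? x) (reverse u))
      w₄ = takeWhile (λ a → a <? x) v
      w₅ = dropWhile (λ a → a <? x) v
  in w₁ ++ w₄ ++ x ∷ w₂ ++ w₅

lastOr : ℕ → List ℕ → ℕ
lastOr d [] = d
lastOr d (a ∷ []) = a
lastOr d (a ∷ b ∷ w) = lastOr d (b ∷ w)

headOr : ℕ → List ℕ → ℕ
headOr d [] = d
headOr d (a ∷ _) = a

-- x is a double ascent or a double descent of π (with a₀ = a_{n+1} = n+1,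
-- n = length π)
isDADD : ℕ → List ℕ → Bool
isDADD x π with splitAtLetter x π
... | nothing = false
... | just (u , v) =
  let b = suc (length π)
      l = lastOr b u
      r = headOr b v
  in ((l <ᵇ x) ∧ (x <ᵇ r)) ∨ ((x <ᵇ l) ∧ (r <ᵇ x))

φ′ : ℕ → List ℕ → List ℕ
φ′ x π = if isDADD x π then φ x π else π

-- φ'_S = ∏_{x ∈ S} φ'_x, S given as a list of its (distinct) elements
φ′S : List ℕ → List ℕ → List ℕ
φ′S S π = foldr φ′ π S

Invariant : ℕ → (List ℕ → Set) → Set
Invariant n T = ∀ (S : List ℕ) → Unique S → All (λ x → 1 ≤ x × x ≤ n) S →
                ∀ π → T π → T (φ′S S π)

data BTree : Set where
  leaf : BTree
  node : BTree → ℕ → BTree → BTree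

maxList : List ℕ → ℕ
maxList = foldr _⊔_ 0

-- fuel-driven construction (fuel = length w suffices)
buildB : ℕ → List ℕ → BTree
buildB zero w = leaf
buildB (suc k) [] = leaf
buildB (suc k) (a ∷ w) with splitAtLetter (maxList (a ∷ w)) (a ∷ w)
... | nothing = leaf
... | just (L , R) = node (buildB k L) (maxList (a ∷ w)) (buildB k R)

decTree : List ℕ → BTree
decTree w = buildB (length w) w

labels : BTree → List ℕ
labels leaf = []
labels (node l m r) = labels l ++ m ∷ labels r

memb : ℕ → List ℕ → Bool
memb x = any (λ a → x ≡ᵇ a)

rEdges : BTree → ℕ → ℕ
rEdges leaf x = 0
rEdges (node l m r) x =
  if x ≡ᵇ m then 0
  else if memb x (labels l) then rEdges l x
  else suc (rEdges r x)

r : List ℕ → ℕ → ℕ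
r π x = rEdges (decTree π) x

isOdd : ℕ → Bool
isOdd zero = false
isOdd (suc n) = not (isOdd n)

Odd : List ℕ → List ℕ
Odd π = filter (λ x → isOdd (r π x) Data.Bool.≟ true) π

Ψ′ : List ℕ → List ℕ
Ψ′ π = φ′S (Odd π) π

des : List ℕ → ℕ
des [] = 0
des (a ∷ []) = 0
des (a ∷ b ∷ w) = (if b <ᵇ a then 1 else 0) + des (b ∷ w)

-- Unordered decreasing tree T(w; m); the label nothing stands for ∞.

data Rose : Set where
  rose : Maybe ℕ → List Rose → Rose

-- decomposition w = m₁ w₁ m₂ w₂ ⋯ m_k w_k at the left-to-right maxima
blocks : ℕ → List ℕ → List (ℕ × List ℕ)
blocks zero w = []
blocks (suc k) [] = []
blocks (suc k) (a ∷ w) =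
  (a , takeWhile (λ b → b <? a) w) ∷ blocks k (dropWhile (λ b → b <? a) w)

mutual
  buildR : ℕ → Maybe ℕ → List ℕ → Rose
  buildR zero m w = rose m []
  buildR (suc k) m w = rose m (buildRs k (blocks (length w) w))

  buildRs : ℕ → List (ℕ × List ℕ) → List Rose
  buildRs k [] = []
  buildRs k ((mᵢ , wᵢ) ∷ bs) = buildR k (just mᵢ) wᵢ ∷ buildRs k bs

-- T(w; m), fuel = length w + 1 suffices
utree : List ℕ → Maybe ℕ → Rose
utree w m = buildR (suc (length w)) m w

mutual
  ev : Rose → ℕ
  ev (rose _ cs) = suc (odL cs)

  od : Rose → ℕ
  od (rose _ cs) = evL cs

  evL : List Rose → ℕ
  evL [] = 0
  evL (c ∷ cs) = ev c + evL cs

  odL : List Rose → ℕ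
  odL [] = 0
  odL (c ∷ cs) = od c + odL cs

-- number of non-root vertices of T(π; ∞) at even distance from the root
veh : List ℕ → ℕ
veh π with utree π nothing
... | rose _ cs = odL cs

open import Relation.Binary.PropositionalEquality using (_≡_; refl)
private
  t1 : decTree (2 ∷ 3 ∷ 1 ∷ []) ≡ node (node leaf 2 leaf) 3 (node leaf 1 leaf)
  t1 = refl
  t2 : Odd (2 ∷ 3 ∷ 1 ∷ []) ≡ 1 ∷ []
  t2 = refl
  -- π = 2 1 3: 1 is a valley; 2 is a double descent (a0=4): φ_2(213)=123
  t3 : φ′ 2 (2 ∷ 1 ∷ 3 ∷ []) ≡ 1 ∷ 2 ∷ 3 ∷ []
  t3 = refl
  t4 : φ′ 1 (2 ∷ 1 ∷ 3 ∷ []) ≡ 2 ∷ 1 ∷ 3 ∷ []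
  t4 = refl
  -- T(3 1 2; ∞): ∞ - 3 - {1,2}: veh = 2
  t5 : veh (3 ∷ 1 ∷ 2 ∷ []) ≡ 2
  t5 = refl
  t6 : veh (1 ∷ 2 ∷ 3 ∷ []) ≡ 0
  t6 = refl
  t7 : des (3 ∷ 1 ∷ 2 ∷ []) ≡ 1
  t7 = refl

{-# OPTIONS --safe #-}

-- A permutation is the in-order reading word of its decreasing binary tree. For a letter
-- x, the maximal runs of smaller letters on either side of x are the reading words of the
-- two subtrees of x, so x is a double ascent or descent exactly when it has one child, and
-- φ′_x swaps its two subtrees. Hence φ′_S swaps the subtrees of the one-child nodes in S,
-- and Ψ′ swaps those of the one-child nodes at odd right depth. Swapping does not change
-- which nodes have one child, so these swaps can be detected and undone from the root
-- down: Ψ′ is injective, and its inverse stays in T since π = φ′_{Odd π}(Ψ′ π) by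
-- involutivity. A descent of a reading word is a node with a non-empty right subtree;
-- counting these in the swapped tree gives the number of nodes at odd right depth, and
-- these are the vertices at even positive depth of T(π; ∞), since the depth of a vertex
-- there is one more than its right depth in the binary tree.

module Submission where

open import Defs
open import Data.Bool using (Bool; true; false; if_then_else_; _∧_; _∨_; not; _xor_)
import Data.Bool.Properties as Bool
open import Data.Nat using (ℕ; zero; suc; _+_; _≤_; _<_; _≮_; _<ᵇ_; _≡ᵇ_; z≤n; s≤s; s≤s⁻¹; _<?_)
open import Data.Nat.Properties
open import Data.Nat.Tactic.RingSolver using (solve-∀)
open import Data.List
  using (List; []; _∷_; _++_; [_]; reverse; takeWhile; dropWhile; length; foldr; filter; null; upTo)
open import Data.List.Properties
  using (++-assoc; ++-identityʳ; reverse-++; unfold-reverse; reverse-involutive; length-++; length-map; length-upTo)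
open import Data.List.Membership.Propositional using (_∈_; _∉_)
open import Data.List.Membership.DecPropositional _≟_ using (_∈?_)
open import Data.List.Membership.Propositional.Properties using (∈-++⁺ˡ; ∈-++⁺ʳ; ∈-++⁻; ∈-∃++)
open import Data.List.Relation.Unary.Any using (here; there)
open import Data.List.Relation.Unary.All using (All; []; _∷_; lookup)
import Data.List.Relation.Unary.All as All
import Data.List.Relation.Unary.All.Properties as All
open import Data.List.Relation.Unary.Unique.Propositional using (Unique; []; _∷_)
import Data.List.Relation.Unary.Unique.Propositional.Properties as Unique
open import Data.List.Relation.Binary.Disjoint.Propositional using (Disjoint)
open import Data.List.Relation.Binary.Permutation.Propositional using (_↭_; ↭-refl; ↭-sym; ↭-trans; ↭⇒↭ₛ)
open import Data.List.Relation.Binary.Permutation.Propositional.Properties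
  using (All-resp-↭; ↭-length; ++⁺; ++-comm; shift; ↭-reverse)
import Data.List.Relation.Binary.Permutation.Setoid.Properties as PermutationₛProperties
open import Data.Maybe using (just; nothing)
open import Data.Product using (_×_; _,_; proj₁; proj₂; ∃)
open import Data.Sum using (inj₁; inj₂)
open import Function using (_∘_; id)
open import Relation.Nullary using (¬_; yes; no; does)
open import Relation.Nullary.Decidable using (dec-true; dec-false)
open import Relation.Unary using (Decidable)
open import Relation.Binary.Definitions using (_Respects_)
open import Relation.Binary.PropositionalEquality
  using (_≡_; _≢_; refl; sym; trans; cong; cong₂; subst; setoid; module ≡-Reasoning)
open ≡-Reasoning

≡ᵇ-refl : ∀ m → (m ≡ᵇ m) ≡ true
≡ᵇ-refl m = dec-true (m ≟ m) refl

≢⇒≡ᵇ≡false : ∀ {m n} → m ≢ n → (m ≡ᵇ n) ≡ false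
≢⇒≡ᵇ≡false {m} {n} = dec-false (m ≟ n)

<⇒<ᵇ≡true : ∀ {m n} → m < n → (m <ᵇ n) ≡ true
<⇒<ᵇ≡true {m} {n} = dec-true (m <? n)

≮⇒<ᵇ≡false : ∀ {m n} → m ≮ n → (m <ᵇ n) ≡ false
≮⇒<ᵇ≡false {m} {n} = dec-false (m <? n)

Unique-resp-↭ : Unique {A = ℕ} Respects _↭_
Unique-resp-↭ p = PermutationₛProperties.Unique-resp-↭ (setoid ℕ) (↭⇒↭ₛ p)

Unique-++⁻ˡ : ∀ (xs : List ℕ) {ys} → Unique (xs ++ ys) → Unique xs
Unique-++⁻ˡ []       _           = []
Unique-++⁻ˡ (x ∷ xs) (x∉ ∷ xs!) = All.++⁻ˡ xs x∉ ∷ Unique-++⁻ˡ xs xs!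

Unique-++⁻ʳ : ∀ (xs : List ℕ) {ys} → Unique (xs ++ ys) → Unique ys
Unique-++⁻ʳ []       ys!        = ys!
Unique-++⁻ʳ (x ∷ xs) (_ ∷ xs!) = Unique-++⁻ʳ xs xs!

Unique-++⇒Disjoint : ∀ (xs : List ℕ) {ys} → Unique (xs ++ ys) → Disjoint xs ys
Unique-++⇒Disjoint (x ∷ xs) (x∉ ∷ _)  (here refl , y∈ys) = lookup (All.++⁻ʳ xs x∉) y∈ys refl
Unique-++⇒Disjoint (x ∷ xs) (_ ∷ xs!) (there y∈xs , y∈ys) = Unique-++⇒Disjoint xs xs! (y∈xs , y∈ys)

All<⇒∉ : ∀ {m} {xs : List ℕ} → All (_< m) xs → m ∉ xs
All<⇒∉ xs<m m∈xs = <-irrefl refl (lookup xs<m m∈xs)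

All≤∧∉⇒All< : ∀ {m} {xs : List ℕ} → All (_≤ m) xs → m ∉ xs → All (_< m) xs
All≤∧∉⇒All< xs≤m m∉xs = All.tabulate λ y∈xs →
  ≤∧≢⇒< (lookup xs≤m y∈xs) λ { refl → m∉xs y∈xs }

splitAtLetter-∉ : ∀ {x} w → x ∉ w → splitAtLetter x w ≡ nothing
splitAtLetter-∉       []      _   = refl
splitAtLetter-∉ {x} (a ∷ w) x∉w
  rewrite ≢⇒≡ᵇ≡false (x∉w ∘ here) | splitAtLetter-∉ w (x∉w ∘ there) = refl

splitAtLetter-++ : ∀ {x} L R → x ∉ L → splitAtLetter x (L ++ x ∷ R) ≡ just (L , R)
splitAtLetter-++ {x} []      R _   rewrite ≡ᵇ-refl x = refl
splitAtLetter-++ {x} (a ∷ L) R x∉L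
  rewrite ≢⇒≡ᵇ≡false (x∉L ∘ here) | splitAtLetter-++ L R (x∉L ∘ there) = refl

maxList-upper : ∀ w → All (_≤ maxList w) w
maxList-upper []      = []
maxList-upper (a ∷ w) = m≤m⊔n a _ ∷ All.map (λ b≤ → ≤-trans b≤ (m≤n⊔m a _)) (maxList-upper w)

maxList-least : ∀ {m} w → All (_≤ m) w → maxList w ≤ m
maxList-least []      []         = z≤n
maxList-least (_ ∷ w) (a≤ ∷ w≤) = ⊔-lub a≤ (maxList-least w w≤)

maxList-∈ : ∀ a w → maxList (a ∷ w) ∈ a ∷ w
maxList-∈ a []      rewrite ⊔-identityʳ a = here refl
maxList-∈ a (b ∷ w) with ⊔-sel a (maxList (b ∷ w))
... | inj₁ eq rewrite eq = here refl
... | inj₂ eq rewrite eq = there (maxList-∈ b w)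

maxList-peak : ∀ {m} L R → All (_< m) L → All (_< m) R → maxList (L ++ m ∷ R) ≡ m
maxList-peak L R L<m R<m = ≤-antisym
  (maxList-least (L ++ _ ∷ R) (All.++⁺ (All.map <⇒≤ L<m) (≤-refl ∷ All.map <⇒≤ R<m)))
  (lookup (maxList-upper (L ++ _ ∷ R)) (∈-++⁺ʳ L (here refl)))

-- Decreasing binary trees

data Decreasing : BTree → Set where
  leaf : Decreasing leaf
  node : ∀ {l m r} → All (_< m) (labels l) → All (_< m) (labels r) →
         Decreasing l → Decreasing r → Decreasing (node l m r)

size : BTree → ℕ
size t = length (labels t)

size-node : ∀ l m r → size (node l m r) ≡ suc (size l + size r)
size-node l m r = trans (length-++ (labels l)) (+-suc (size l) (size r))

buildB-node : ∀ k {m} L R → All (_< m) L → All (_< m) R →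
              buildB (suc k) (L ++ m ∷ R) ≡ node (buildB k L) m (buildB k R)
buildB-node k []      R L<m R<m
  rewrite maxList-peak [] R L<m R<m | splitAtLetter-++ [] R (All<⇒∉ L<m)
        | maxList-peak [] R L<m R<m = refl
buildB-node k (a ∷ L) R L<m R<m
  rewrite maxList-peak (a ∷ L) R L<m R<m | splitAtLetter-++ (a ∷ L) R (All<⇒∉ L<m)
        | maxList-peak (a ∷ L) R L<m R<m = refl

buildB-labels : ∀ k {t} → Decreasing t → size t ≤ k → buildB k (labels t) ≡ t
buildB-labels zero    leaf _ = refl
buildB-labels (suc k) leaf _ = refl
buildB-labels zero    {node l m r} _ size≤0 with () ← subst (_≤ 0) (size-node l m r) size≤0
buildB-labels (suc k) {node l m r} (node l<m r<m dl dr) size≤ = begin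
  buildB (suc k) (labels l ++ m ∷ labels r) ≡⟨ buildB-node k (labels l) (labels r) l<m r<m ⟩
  node (buildB k (labels l)) m (buildB k (labels r))
    ≡⟨ cong₂ (λ l′ r′ → node l′ m r′) (buildB-labels k dl (m+n≤o⇒m≤o (size l) sizes≤))
                                       (buildB-labels k dr (m+n≤o⇒n≤o (size l) sizes≤)) ⟩
  node l m r ∎
  where
  sizes≤ : size l + size r ≤ k
  sizes≤ = s≤s⁻¹ (subst (_≤ suc k) (size-node l m r) size≤)

decTree-labels : ∀ {t} → Decreasing t → decTree (labels t) ≡ t
decTree-labels dt = buildB-labels _ dt ≤-refl

buildB-correct : ∀ k w → Unique w → length w ≤ k →
                 labels (buildB k w) ≡ w × Decreasing (buildB k w)
buildB-correct zero    []      _ _  = refl , leaf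
buildB-correct (suc k) []      _ _  = refl , leaf
buildB-correct (suc k) (a ∷ w) w! len≤
  with L , R , w≡ ← ∈-∃++ (maxList-∈ a w) =
  subst (λ t → labels t ≡ a ∷ w × Decreasing t) (sym build≡)
    (trans (cong₂ (λ L′ R′ → L′ ++ m ∷ R′) (proj₁ ihL) (proj₁ ihR)) (sym w≡) ,
     node (subst (All (_< m)) (sym (proj₁ ihL)) L<m) (subst (All (_< m)) (sym (proj₁ ihR)) R<m)
          (proj₂ ihL) (proj₂ ihR))
  where
  m : ℕ
  m = maxList (a ∷ w)
  LmR! : Unique (L ++ m ∷ R)
  LmR! = subst Unique w≡ w!
  LmR≤m : All (_≤ m) (L ++ m ∷ R)
  LmR≤m = subst (All (_≤ m)) w≡ (maxList-upper (a ∷ w))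
  L<m : All (_< m) L
  L<m = All≤∧∉⇒All< (All.++⁻ˡ L LmR≤m) (λ m∈L → Unique-++⇒Disjoint L LmR! (m∈L , here refl))
  R<m : All (_< m) R
  R<m = All≤∧∉⇒All< (All.drop⁺ 1 (All.++⁻ʳ L LmR≤m)) (Unique.Unique[x∷xs]⇒x∉xs (Unique-++⁻ʳ L LmR!))
  lengths≤ : length L + length R ≤ k
  lengths≤ = s≤s⁻¹ (subst (_≤ suc k)
    (trans (cong length w≡) (trans (length-++ L) (+-suc (length L) (length R)))) len≤)
  build≡ : buildB (suc k) (a ∷ w) ≡ node (buildB k L) m (buildB k R)
  build≡ = trans (cong (buildB (suc k)) w≡) (buildB-node k L R L<m R<m)
  ihL : labels (buildB k L) ≡ L × Decreasing (buildB k L)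
  ihL = buildB-correct k L (Unique-++⁻ˡ L LmR!) (m+n≤o⇒m≤o (length L) lengths≤)
  ihR : labels (buildB k R) ≡ R × Decreasing (buildB k R)
  ihR = buildB-correct k R (Unique.drop⁺ 1 (Unique-++⁻ʳ L LmR!)) (m+n≤o⇒n≤o (length L) lengths≤)

labels-decTree : ∀ {w} → Unique w → labels (decTree w) ≡ w
labels-decTree w! = proj₁ (buildB-correct _ _ w! ≤-refl)

decTree-Decreasing : ∀ {w} → Unique w → Decreasing (decTree w)
decTree-Decreasing w! = proj₂ (buildB-correct _ _ w! ≤-refl)

-- Swapping subtrees

isLeaf : BTree → Bool
isLeaf leaf         = true
isLeaf (node _ _ _) = false

exactlyOneLeaf : BTree → BTree → Bool
exactlyOneLeaf l r = isLeaf l xor isLeaf r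

swapIf : Bool → BTree → BTree
swapIf false t            = t
swapIf true  leaf         = leaf
swapIf true  (node l m r) = node r m l

swapAt : (ℕ → Bool) → BTree → BTree
swapAt f leaf         = leaf
swapAt f (node l m r) = swapIf (f m ∧ exactlyOneLeaf l r) (node (swapAt f l) m (swapAt f r))

isLeaf-swapIf : ∀ b t → isLeaf (swapIf b t) ≡ isLeaf t
isLeaf-swapIf false t            = refl
isLeaf-swapIf true  leaf         = refl
isLeaf-swapIf true  (node _ _ _) = refl

isLeaf-swapAt : ∀ f t → isLeaf (swapAt f t) ≡ isLeaf t
isLeaf-swapAt f leaf         = refl
isLeaf-swapAt f (node l m r) = isLeaf-swapIf _ _

exactlyOneLeaf-swapAt : ∀ f g l r → exactlyOneLeaf (swapAt f l) (swapAt g r) ≡ exactlyOneLeaf l r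
exactlyOneLeaf-swapAt f g l r = cong₂ _xor_ (isLeaf-swapAt f l) (isLeaf-swapAt g r)

swapIf-swapIf : ∀ a b t → swapIf a (swapIf b t) ≡ swapIf (a xor b) t
swapIf-swapIf false b     t            = refl
swapIf-swapIf true  false t            = refl
swapIf-swapIf true  true  leaf         = refl
swapIf-swapIf true  true  (node _ _ _) = refl

swapAt-swapIf : ∀ f b t → swapAt f (swapIf b t) ≡ swapIf b (swapAt f t)
swapAt-swapIf f false t            = refl
swapAt-swapIf f true  leaf         = refl
swapAt-swapIf f true  (node l m r)
  rewrite Bool.xor-comm (isLeaf r) (isLeaf l) with f m ∧ exactlyOneLeaf l r
... | false = refl
... | true  = refl

swapAt-∘ : ∀ f g t → swapAt f (swapAt g t) ≡ swapAt (λ x → f x xor g x) t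
swapAt-∘ f g leaf         = refl
swapAt-∘ f g (node l m r) = begin
  swapAt f (swapIf (g m ∧ e) (node (swapAt g l) m (swapAt g r)))
    ≡⟨ swapAt-swapIf f (g m ∧ e) _ ⟩
  swapIf (g m ∧ e) (swapIf (f m ∧ exactlyOneLeaf (swapAt g l) (swapAt g r)) fg-node)
    ≡⟨ cong (λ c → swapIf (g m ∧ e) (swapIf (f m ∧ c) fg-node)) (exactlyOneLeaf-swapAt g g l r) ⟩
  swapIf (g m ∧ e) (swapIf (f m ∧ e) fg-node)
    ≡⟨ swapIf-swapIf (g m ∧ e) (f m ∧ e) fg-node ⟩
  swapIf ((g m ∧ e) xor (f m ∧ e)) fg-node
    ≡⟨ cong₂ swapIf (trans (sym (Bool.∧-distribʳ-xor e (g m) (f m))) (cong (_∧ e) (Bool.xor-comm (g m) (f m))))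
                    (cong₂ (λ l′ r′ → node l′ m r′) (swapAt-∘ f g l) (swapAt-∘ f g r)) ⟩
  swapAt (λ x → f x xor g x) (node l m r) ∎
  where
  e : Bool
  e = exactlyOneLeaf l r
  fg-node : BTree
  fg-node = node (swapAt f (swapAt g l)) m (swapAt f (swapAt g r))

swapAt-cong : ∀ {f g} t → (∀ {y} → y ∈ labels t → f y ≡ g y) → swapAt f t ≡ swapAt g t
swapAt-cong leaf         f≗g = refl
swapAt-cong (node l m r) f≗g = cong₂ (λ c t → swapIf (c ∧ exactlyOneLeaf l r) t)
  (f≗g (∈-++⁺ʳ (labels l) (here refl)))
  (cong₂ (λ l′ r′ → node l′ m r′) (swapAt-cong l (f≗g ∘ ∈-++⁺ˡ))
                                  (swapAt-cong r (f≗g ∘ ∈-++⁺ʳ (labels l) ∘ there)))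

swapAt-nowhere : ∀ t → swapAt (λ _ → false) t ≡ t
swapAt-nowhere leaf         = refl
swapAt-nowhere (node l m r) = cong₂ (λ l′ r′ → node l′ m r′) (swapAt-nowhere l) (swapAt-nowhere r)

swapAt-involutive : ∀ f t → swapAt f (swapAt f t) ≡ t
swapAt-involutive f t = begin
  swapAt f (swapAt f t)              ≡⟨ swapAt-∘ f f t ⟩
  swapAt (λ x → f x xor f x) t       ≡⟨ swapAt-cong t (λ {y} _ → Bool.xor-same (f y)) ⟩
  swapAt (λ _ → false) t             ≡⟨ swapAt-nowhere t ⟩
  t                                  ∎

swapAt-∉ : ∀ {x} t → x ∉ labels t → swapAt (x ≡ᵇ_) t ≡ t
swapAt-∉ {x} t x∉t = trans (swapAt-cong t (λ {y} y∈t → ≢⇒≡ᵇ≡false {x} {y} λ { refl → x∉t y∈t }))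
                            (swapAt-nowhere t)

labels-swapIf : ∀ b t → labels (swapIf b t) ↭ labels t
labels-swapIf false t            = ↭-refl
labels-swapIf true  leaf         = ↭-refl
labels-swapIf true  (node l m r) =
  ↭-trans (++-comm (labels r) (m ∷ labels l)) (↭-sym (shift m (labels l) (labels r)))

labels-swapAt : ∀ f t → labels (swapAt f t) ↭ labels t
labels-swapAt f leaf         = ↭-refl
labels-swapAt f (node l m r) =
  ↭-trans (labels-swapIf (f m ∧ exactlyOneLeaf l r) (node (swapAt f l) m (swapAt f r)))
          (++⁺ (labels-swapAt f l) (_↭_.prep m (labels-swapAt f r)))

Decreasing-swapIf : ∀ b {t} → Decreasing t → Decreasing (swapIf b t)
Decreasing-swapIf false dt                    = dt
Decreasing-swapIf true  leaf                  = leaf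
Decreasing-swapIf true  (node l<m r<m dl dr) = node r<m l<m dr dl

Decreasing-swapAt : ∀ f {t} → Decreasing t → Decreasing (swapAt f t)
Decreasing-swapAt f leaf                                 = leaf
Decreasing-swapAt f {node l m r} (node l<m r<m dl dr) = Decreasing-swapIf _
  (node (All-resp-↭ (↭-sym (labels-swapAt f l)) l<m) (All-resp-↭ (↭-sym (labels-swapAt f r)) r<m)
        (Decreasing-swapAt f dl) (Decreasing-swapAt f dr))

-- φ′ at a letter flanked by runs of smaller letters

-- StartsAbove x (reverse Lc) says that Lc is empty or ends with a letter above x.
data StartsAbove (x : ℕ) : List ℕ → Set where
  []    : StartsAbove x []
  above : ∀ {y ys} → x < y → StartsAbove x (y ∷ ys)

StartsAbove-++ : ∀ {x m} R Z → x < m → StartsAbove x R → StartsAbove x (R ++ m ∷ Z)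
StartsAbove-++ []      Z x<m []          = above x<m
StartsAbove-++ (_ ∷ _) Z _   (above x<y) = above x<y

module _ {x : ℕ} where

  takeWhile-run : ∀ {xs} ys → All (_< x) xs → StartsAbove x ys → takeWhile (_<? x) (xs ++ ys) ≡ xs
  takeWhile-run []       []           []          = refl
  takeWhile-run (y ∷ ys) []           (above x<y) rewrite dec-false (y <? x) (<⇒≯ x<y) = refl
  takeWhile-run ys       (a<x ∷ xs<x) ys>x        rewrite dec-true (_ <? x) a<x =
    cong (_ ∷_) (takeWhile-run ys xs<x ys>x)

  dropWhile-run : ∀ {xs} ys → All (_< x) xs → StartsAbove x ys → dropWhile (_<? x) (xs ++ ys) ≡ ys
  dropWhile-run []       []           []          = refl
  dropWhile-run (y ∷ ys) []           (above x<y) rewrite dec-false (y <? x) (<⇒≯ x<y) = refl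
  dropWhile-run ys       (a<x ∷ xs<x) ys>x        rewrite dec-true (_ <? x) a<x =
    dropWhile-run ys xs<x ys>x

All-reverse : ∀ {P : ℕ → Set} {xs} → All P xs → All P (reverse xs)
All-reverse {xs = xs} = All-resp-↭ (↭-sym (↭-reverse xs))

∉-++ : ∀ {x} Lc {A} → x ∉ Lc → All (_< x) A → x ∉ Lc ++ A
∉-++ Lc x∉Lc A<x x∈ with ∈-++⁻ Lc x∈
... | inj₁ x∈Lc = x∉Lc x∈Lc
... | inj₂ x∈A  = All<⇒∉ A<x x∈A

φ-run : ∀ {x} Lc A B Rc → StartsAbove x (reverse Lc) → StartsAbove x Rc →
        All (_< x) A → All (_< x) B → x ∉ Lc →
        φ x ((Lc ++ A) ++ x ∷ B ++ Rc) ≡ Lc ++ B ++ x ∷ A ++ Rc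
φ-run Lc A B Rc Lc>x Rc>x A<x B<x x∉Lc
  rewrite splitAtLetter-++ (Lc ++ A) (B ++ Rc) (∉-++ Lc x∉Lc A<x)
        | reverse-++ Lc A
        | takeWhile-run (reverse Lc) (All-reverse A<x) Lc>x
        | dropWhile-run (reverse Lc) (All-reverse A<x) Lc>x
        | reverse-involutive A | reverse-involutive Lc
        | takeWhile-run Rc B<x Rc>x | dropWhile-run Rc B<x Rc>x = refl

lastOr-∷ : ∀ d y ys → lastOr d (y ∷ ys) ≡ lastOr y ys
lastOr-∷ d y []       = refl
lastOr-∷ d y (z ∷ zs) = trans (lastOr-∷ d z zs) (sym (lastOr-∷ y z zs))

headOr-∷ʳ : ∀ d ys y → headOr d (ys ++ [ y ]) ≡ headOr y ys
headOr-∷ʳ d []      y = refl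
headOr-∷ʳ d (_ ∷ _) y = refl

lastOr≡headOr∘reverse : ∀ d xs → lastOr d xs ≡ headOr d (reverse xs)
lastOr≡headOr∘reverse d []       = refl
lastOr≡headOr∘reverse d (x ∷ xs) = begin
  lastOr d (x ∷ xs)              ≡⟨ lastOr-∷ d x xs ⟩
  lastOr x xs                    ≡⟨ lastOr≡headOr∘reverse x xs ⟩
  headOr x (reverse xs)          ≡⟨ headOr-∷ʳ d (reverse xs) x ⟨
  headOr d (reverse xs ++ [ x ]) ≡⟨ cong (headOr d) (unfold-reverse x xs) ⟨
  headOr d (reverse (x ∷ xs))    ∎

null-++-∷ : ∀ xs {y} {ys : List ℕ} → null (xs ++ y ∷ ys) ≡ false
null-++-∷ []      = refl
null-++-∷ (_ ∷ _) = refl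

null-reverse : ∀ (xs : List ℕ) → null (reverse xs) ≡ null xs
null-reverse []       = refl
null-reverse (x ∷ xs) = trans (cong null (unfold-reverse x xs)) (null-++-∷ (reverse xs))

null-labels : ∀ t → null (labels t) ≡ isLeaf t
null-labels leaf         = refl
null-labels (node l _ _) = null-++-∷ (labels l)

data Neighbour (x y : ℕ) : Bool → Set where
  higher : x < y → Neighbour x y true
  lower  : y < x → Neighbour x y false

neighbour : ∀ {x d A R} → All (_< x) A → StartsAbove x R → x < d →
            Neighbour x (headOr d (A ++ R)) (null A)
neighbour []        []          x<d = higher x<d
neighbour []        (above x<y) _   = higher x<y
neighbour (a<x ∷ _) _           _   = lower a<x

isDADD-neighbours : ∀ {x l r p q} → Neighbour x l p → Neighbour x r q →
                    ((l <ᵇ x) ∧ (x <ᵇ r)) ∨ ((x <ᵇ l) ∧ (r <ᵇ x)) ≡ p xor q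
isDADD-neighbours (higher x<l) (higher x<r)
  rewrite ≮⇒<ᵇ≡false (<⇒≯ x<l) | <⇒<ᵇ≡true x<l | ≮⇒<ᵇ≡false (<⇒≯ x<r) = refl
isDADD-neighbours (higher x<l) (lower r<x)
  rewrite ≮⇒<ᵇ≡false (<⇒≯ x<l) | <⇒<ᵇ≡true x<l | <⇒<ᵇ≡true r<x = refl
isDADD-neighbours (lower l<x)  (higher x<r)
  rewrite <⇒<ᵇ≡true l<x | <⇒<ᵇ≡true x<r = refl
isDADD-neighbours (lower l<x)  (lower r<x)
  rewrite <⇒<ᵇ≡true l<x | ≮⇒<ᵇ≡false (<⇒≯ r<x) | ≮⇒<ᵇ≡false (<⇒≯ l<x) = refl

isDADD-run : ∀ {x} Lc A B Rc → StartsAbove x (reverse Lc) → StartsAbove x Rc →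
             All (_< x) A → All (_< x) B → x ∉ Lc → x ≤ length ((Lc ++ A) ++ x ∷ B ++ Rc) →
             isDADD x ((Lc ++ A) ++ x ∷ B ++ Rc) ≡ null A xor null B
isDADD-run {x} Lc A B Rc Lc>x Rc>x A<x B<x x∉Lc x≤len
  rewrite splitAtLetter-++ (Lc ++ A) (B ++ Rc) (∉-++ Lc x∉Lc A<x)
        | lastOr≡headOr∘reverse (suc (length ((Lc ++ A) ++ x ∷ B ++ Rc))) (Lc ++ A)
        | reverse-++ Lc A
  = trans (isDADD-neighbours (neighbour (All-reverse A<x) Lc>x (s≤s x≤len)) (neighbour B<x Rc>x (s≤s x≤len)))
          (cong (_xor null B) (null-reverse A))

++-focus : ∀ (Lc A : List ℕ) x B Rc → Lc ++ (A ++ x ∷ B) ++ Rc ≡ (Lc ++ A) ++ x ∷ B ++ Rc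
++-focus Lc A x B Rc = trans (cong (Lc ++_) (++-assoc A (x ∷ B) Rc)) (sym (++-assoc Lc A (x ∷ B ++ Rc)))

φ′-run : ∀ {x} Lc A B Rc → StartsAbove x (reverse Lc) → StartsAbove x Rc →
         All (_< x) A → All (_< x) B → x ∉ Lc → x ≤ length (Lc ++ (A ++ x ∷ B) ++ Rc) →
         φ′ x (Lc ++ (A ++ x ∷ B) ++ Rc) ≡
         Lc ++ (if null A xor null B then B ++ x ∷ A else A ++ x ∷ B) ++ Rc
φ′-run {x} Lc A B Rc Lc>x Rc>x A<x B<x x∉Lc x≤len = begin
  φ′ x (Lc ++ (A ++ x ∷ B) ++ Rc)
    ≡⟨ cong (φ′ x) (++-focus Lc A x B Rc) ⟩
  (if isDADD x w then φ x w else w)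
    ≡⟨ cong (λ c → if c then φ x w else w)
            (isDADD-run Lc A B Rc Lc>x Rc>x A<x B<x x∉Lc
                        (subst (x ≤_) (cong length (++-focus Lc A x B Rc)) x≤len)) ⟩
  (if c then φ x w else w)
    ≡⟨ cong₂ (λ u v → if c then u else v)
             (trans (φ-run Lc A B Rc Lc>x Rc>x A<x B<x x∉Lc) (cong (Lc ++_) (sym (++-assoc B (x ∷ A) Rc))))
             (sym (++-focus Lc A x B Rc)) ⟩
  (if c then Lc ++ (B ++ x ∷ A) ++ Rc else Lc ++ (A ++ x ∷ B) ++ Rc)
    ≡⟨ Bool.if-float (λ M → Lc ++ M ++ Rc) c ⟨
  Lc ++ (if c then B ++ x ∷ A else A ++ x ∷ B) ++ Rc ∎
  where
  w : List ℕ
  w = (Lc ++ A) ++ x ∷ B ++ Rc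
  c : Bool
  c = null A xor null B

-- φ′ on the reading word of a decreasing tree

labels-swapIf-node : ∀ a x b → labels (swapIf (exactlyOneLeaf a b) (node a x b)) ≡
  (if null (labels a) xor null (labels b) then labels b ++ x ∷ labels a else labels a ++ x ∷ labels b)
labels-swapIf-node a x b rewrite null-labels a | null-labels b with exactlyOneLeaf a b
... | true  = refl
... | false = refl

-- The reading word of t split around the subtree rooted at x.
record Focus (x : ℕ) (t : BTree) : Set where
  field
    before after  : List ℕ
    left right    : BTree
    before>x      : StartsAbove x (reverse before)
    after>x       : StartsAbove x after
    left<x        : All (_< x) (labels left)
    right<x       : All (_< x) (labels right)
    labels-t      : labels t ≡ before ++ labels (node left x right) ++ after
    labels-swapped : labels (swapAt (x ≡ᵇ_) t) ≡
                    before ++ labels (swapIf (exactlyOneLeaf left right) (node left x right)) ++ after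

reverse-++-∷ : ∀ (xs : List ℕ) {y} ys → reverse (xs ++ y ∷ ys) ≡ reverse ys ++ y ∷ reverse xs
reverse-++-∷ xs {y} ys = begin
  reverse (xs ++ y ∷ ys)              ≡⟨ reverse-++ xs (y ∷ ys) ⟩
  reverse (y ∷ ys) ++ reverse xs      ≡⟨ cong (_++ reverse xs) (unfold-reverse y ys) ⟩
  (reverse ys ++ [ y ]) ++ reverse xs ≡⟨ ++-assoc (reverse ys) [ y ] (reverse xs) ⟩
  reverse ys ++ y ∷ reverse xs        ∎

++-assoc₃ : ∀ (xs ys zs ws : List ℕ) → (xs ++ ys ++ zs) ++ ws ≡ xs ++ ys ++ zs ++ ws
++-assoc₃ xs ys zs ws = trans (++-assoc xs (ys ++ zs) ws) (cong (xs ++_) (++-assoc ys zs ws))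

focus : ∀ {x t} → Decreasing t → Unique (labels t) → x ∈ labels t → Focus x t
focus {x} {node l m r} (node l<m r<m dl dr) u x∈ with ∈-++⁻ (labels l) x∈
... | inj₂ (here refl) = record
  { before = [] ; after = [] ; left = l ; right = r
  ; before>x = [] ; after>x = [] ; left<x = l<m ; right<x = r<m
  ; labels-t = sym (++-identityʳ _)
  ; labels-swapped = trans (cong labels swap≡) (sym (++-identityʳ _)) }
  where
  swap≡ : swapAt (m ≡ᵇ_) (node l m r) ≡ swapIf (exactlyOneLeaf l r) (node l m r)
  swap≡ rewrite ≡ᵇ-refl m | swapAt-∉ l (All<⇒∉ l<m) | swapAt-∉ r (All<⇒∉ r<m) = refl
... | inj₁ x∈l = record
  { before = before ; after = after ++ m ∷ labels r ; left = left ; right = right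
  ; before>x = before>x ; after>x = StartsAbove-++ after (labels r) x<m after>x
  ; left<x = left<x ; right<x = right<x
  ; labels-t = trans (cong (_++ m ∷ labels r) labels-t) (++-assoc₃ before _ after _)
  ; labels-swapped = trans (cong labels swap≡)
      (trans (cong (_++ m ∷ labels r) labels-swapped) (++-assoc₃ before _ after _)) }
  where
  open Focus (focus dl (Unique-++⁻ˡ (labels l) u) x∈l)
  x<m : x < m
  x<m = lookup l<m x∈l
  swap≡ : swapAt (x ≡ᵇ_) (node l m r) ≡ node (swapAt (x ≡ᵇ_) l) m r
  swap≡ rewrite ≢⇒≡ᵇ≡false (<⇒≢ x<m)
              | swapAt-∉ r (λ x∈r → Unique-++⇒Disjoint (labels l) u (x∈l , there x∈r)) = refl
... | inj₂ (there x∈r) = record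
  { before = labels l ++ m ∷ before ; after = after ; left = left ; right = right
  ; before>x = subst (StartsAbove x) (sym (reverse-++-∷ (labels l) before))
                 (StartsAbove-++ (reverse before) (reverse (labels l)) x<m before>x)
  ; after>x = after>x ; left<x = left<x ; right<x = right<x
  ; labels-t = trans (cong (λ w → labels l ++ m ∷ w) labels-t) (sym (++-assoc (labels l) (m ∷ before) _))
  ; labels-swapped = trans (cong labels swap≡)
      (trans (cong (λ w → labels l ++ m ∷ w) labels-swapped) (sym (++-assoc (labels l) (m ∷ before) _))) }
  where
  open Focus (focus dr (Unique.drop⁺ 1 (Unique-++⁻ʳ (labels l) u)) x∈r)
  x<m : x < m
  x<m = lookup r<m x∈r
  swap≡ : swapAt (x ≡ᵇ_) (node l m r) ≡ node l m (swapAt (x ≡ᵇ_) r)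
  swap≡ rewrite ≢⇒≡ᵇ≡false (<⇒≢ x<m)
              | swapAt-∉ l (λ x∈l → Unique-++⇒Disjoint (labels l) u (x∈l , there x∈r)) = refl

record WellLabelled (t : BTree) : Set where
  constructor wellLabelled
  field
    decreasing : Decreasing t
    unique     : Unique (labels t)
    -- isDADD compares with the sentinel suc (length w), which must exceed every letter
    bounded    : All (_≤ length (labels t)) (labels t)

WellLabelled-swapAt : ∀ f {t} → WellLabelled t → WellLabelled (swapAt f t)
WellLabelled-swapAt f {t} (wellLabelled dt t! t≤) = wellLabelled
  (Decreasing-swapAt f dt)
  (Unique-resp-↭ (↭-sym (labels-swapAt f t)) t!)
  (subst (λ n → All (_≤ n) (labels (swapAt f t))) (sym (↭-length (labels-swapAt f t)))
         (All-resp-↭ (↭-sym (labels-swapAt f t)) t≤))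

φ′-labels : ∀ x {t} → WellLabelled t → φ′ x (labels t) ≡ labels (swapAt (x ≡ᵇ_) t)
φ′-labels x {t} (wellLabelled dt t! t≤) with x ∈? labels t
... | no x∉t rewrite splitAtLetter-∉ (labels t) x∉t = cong labels (sym (swapAt-∉ t x∉t))
... | yes x∈t = begin
  φ′ x (labels t)
    ≡⟨ cong (φ′ x) labels-t ⟩
  φ′ x (before ++ (labels left ++ x ∷ labels right) ++ after)
    ≡⟨ φ′-run before (labels left) (labels right) after before>x after>x left<x right<x x∉before x≤length ⟩
  before ++ (if null (labels left) xor null (labels right)
             then labels right ++ x ∷ labels left else labels left ++ x ∷ labels right) ++ after
    ≡⟨ cong (λ M → before ++ M ++ after) (labels-swapIf-node left x right) ⟨
  before ++ labels (swapIf (exactlyOneLeaf left right) (node left x right)) ++ after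
    ≡⟨ labels-swapped ⟨
  labels (swapAt (x ≡ᵇ_) t) ∎
  where
  open Focus (focus dt t! x∈t)
  x∉before : x ∉ before
  x∉before x∈before = Unique-++⇒Disjoint before (subst Unique labels-t t!)
    (x∈before , ∈-++⁺ˡ (∈-++⁺ʳ (labels left) (here refl)))
  x≤length : x ≤ length (before ++ (labels left ++ x ∷ labels right) ++ after)
  x≤length = subst (x ≤_) (cong length labels-t) (lookup t≤ x∈t)

-- Parity of multiplicity rather than membership, so that φ′S composes by xor for any S.
occursOddly : List ℕ → ℕ → Bool
occursOddly S y = foldr (λ x b → (x ≡ᵇ y) xor b) false S

φ′S-labels : ∀ S {t} → WellLabelled t → φ′S S (labels t) ≡ labels (swapAt (occursOddly S) t)
φ′S-labels []      {t} _  = cong labels (sym (swapAt-nowhere t))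
φ′S-labels (x ∷ S) {t} wl = begin
  φ′ x (φ′S S (labels t))                           ≡⟨ cong (φ′ x) (φ′S-labels S wl) ⟩
  φ′ x (labels (swapAt (occursOddly S) t))          ≡⟨ φ′-labels x (WellLabelled-swapAt (occursOddly S) wl) ⟩
  labels (swapAt (x ≡ᵇ_) (swapAt (occursOddly S) t)) ≡⟨ cong labels (swapAt-∘ (x ≡ᵇ_) (occursOddly S) t) ⟩
  labels (swapAt (occursOddly (x ∷ S)) t)           ∎

-- Ψ′ on decreasing trees

occursOddly-∉ : ∀ {y} xs → y ∉ xs → occursOddly xs y ≡ false
occursOddly-∉ []       _  = refl
occursOddly-∉ (x ∷ xs) y∉ rewrite ≢⇒≡ᵇ≡false (λ x≡y → y∉ (here (sym x≡y))) =
  occursOddly-∉ xs (y∉ ∘ there)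

occursOddly-∈ : ∀ {y xs} → Unique xs → y ∈ xs → occursOddly xs y ≡ true
occursOddly-∈ {y} (y∉ ∷ _) (here refl)
  rewrite ≡ᵇ-refl y | occursOddly-∉ _ (λ y∈ → lookup y∉ y∈ refl) = refl
occursOddly-∈ (x∉ ∷ xs!) (there y∈) rewrite ≢⇒≡ᵇ≡false (lookup x∉ y∈) = occursOddly-∈ xs! y∈

occursOddly-filter : ∀ {P : ℕ → Set} (P? : Decidable P) xs y →
                     occursOddly (filter P? xs) y ≡ does (P? y) ∧ occursOddly xs y
occursOddly-filter P? []       y = sym (Bool.∧-zeroʳ _)
occursOddly-filter P? (x ∷ xs) y with x ≟ y
... | no x≢y with does (P? x)
...   | true  rewrite ≢⇒≡ᵇ≡false x≢y = occursOddly-filter P? xs y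
...   | false rewrite ≢⇒≡ᵇ≡false x≢y = occursOddly-filter P? xs y
occursOddly-filter P? (x ∷ xs) y | yes refl with does (P? x) in Px
...   | true  rewrite occursOddly-filter P? xs x | Px = refl
...   | false rewrite occursOddly-filter P? xs x | Px = refl

does-≟true : ∀ b → does (b Bool.≟ true) ≡ b
does-≟true true  = refl
does-≟true false = refl

occursOddly-Odd : ∀ {π y} → Unique π → y ∈ π → occursOddly (Odd π) y ≡ isOdd (r π y)
occursOddly-Odd {π} {y} π! y∈π = begin
  occursOddly (Odd π) y
    ≡⟨ occursOddly-filter (λ x → isOdd (r π x) Bool.≟ true) π y ⟩
  does (isOdd (r π y) Bool.≟ true) ∧ occursOddly π y
    ≡⟨ cong₂ _∧_ (does-≟true (isOdd (r π y))) (occursOddly-∈ π! y∈π) ⟩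
  isOdd (r π y) ∧ true
    ≡⟨ Bool.∧-identityʳ _ ⟩
  isOdd (r π y) ∎

memb-∈ : ∀ {y} xs → y ∈ xs → memb y xs ≡ true
memb-∈ {y} (_ ∷ _)  (here refl) rewrite ≡ᵇ-refl y = refl
memb-∈ {y} (x ∷ xs) (there y∈) rewrite memb-∈ xs y∈ = Bool.∨-zeroʳ (y ≡ᵇ x)

memb-∉ : ∀ {y} xs → y ∉ xs → memb y xs ≡ false
memb-∉     []       _   = refl
memb-∉ {y} (x ∷ xs) y∉ rewrite ≢⇒≡ᵇ≡false (y∉ ∘ here) = memb-∉ xs (y∉ ∘ there)

rEdges-left : ∀ {y} l m r → y ≢ m → y ∈ labels l → rEdges (node l m r) y ≡ rEdges l y
rEdges-left l m r y≢m y∈l rewrite ≢⇒≡ᵇ≡false y≢m | memb-∈ (labels l) y∈l = refl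

rEdges-right : ∀ {y} l m r → y ≢ m → y ∉ labels l → rEdges (node l m r) y ≡ suc (rEdges r y)
rEdges-right l m r y≢m y∉l rewrite ≢⇒≡ᵇ≡false y≢m | memb-∉ (labels l) y∉l = refl

-- odd: whether the root of t lies at odd right depth in the whole tree
ψᵀ : Bool → BTree → BTree
ψᵀ odd leaf         = leaf
ψᵀ odd (node l m r) = swapIf (odd ∧ exactlyOneLeaf l r) (node (ψᵀ odd l) m (ψᵀ (not odd) r))

swapAt-rEdges : ∀ b {t} → Decreasing t → Unique (labels t) →
                swapAt (λ y → b xor isOdd (rEdges t y)) t ≡ ψᵀ b t
swapAt-rEdges b leaf                                 _ = refl
swapAt-rEdges b {node l m r} (node l<m r<m dl dr) u =
  cong₂ swapIf root (cong₂ (λ l′ r′ → node l′ m r′) left right)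
  where
  root : (b xor isOdd (rEdges (node l m r) m)) ∧ exactlyOneLeaf l r ≡ b ∧ exactlyOneLeaf l r
  root rewrite ≡ᵇ-refl m = cong (_∧ exactlyOneLeaf l r) (Bool.xor-identityʳ b)
  left : swapAt (λ y → b xor isOdd (rEdges (node l m r) y)) l ≡ ψᵀ b l
  left = trans
    (swapAt-cong l λ y∈l → cong (λ k → b xor isOdd k) (rEdges-left l m r (<⇒≢ (lookup l<m y∈l)) y∈l))
    (swapAt-rEdges b dl (Unique-++⁻ˡ (labels l) u))
  right : swapAt (λ y → b xor isOdd (rEdges (node l m r) y)) r ≡ ψᵀ (not b) r
  right = trans
    (swapAt-cong r λ {y} y∈r → begin
      b xor isOdd (rEdges (node l m r) y)
        ≡⟨ cong (λ k → b xor isOdd k)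
                (rEdges-right l m r (<⇒≢ (lookup r<m y∈r))
                              λ y∈l → Unique-++⇒Disjoint (labels l) u (y∈l , there y∈r)) ⟩
      b xor not (isOdd (rEdges r y)) ≡⟨ Bool.not-distribʳ-xor b _ ⟨
      not (b xor isOdd (rEdges r y)) ≡⟨ Bool.not-distribˡ-xor b _ ⟩
      not b xor isOdd (rEdges r y)   ∎)
    (swapAt-rEdges (not b) dr (Unique.drop⁺ 1 (Unique-++⁻ʳ (labels l) u)))

-- exactlyOneLeaf is invariant under swapping, so at each node one can tell whether ψᵀ
-- swapped it and undo this from the root down.
ψᵀ⁻¹ : Bool → BTree → BTree
ψᵀ⁻¹ odd leaf = leaf
ψᵀ⁻¹ odd (node a m b) with odd ∧ exactlyOneLeaf a b
... | true  = node (ψᵀ⁻¹ odd b) m (ψᵀ⁻¹ (not odd) a)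
... | false = node (ψᵀ⁻¹ odd a) m (ψᵀ⁻¹ (not odd) b)

isLeaf-ψᵀ : ∀ b t → isLeaf (ψᵀ b t) ≡ isLeaf t
isLeaf-ψᵀ b leaf         = refl
isLeaf-ψᵀ b (node _ _ _) = isLeaf-swapIf _ _

isLeaf-ψᵀ⁻¹ : ∀ b t → isLeaf (ψᵀ⁻¹ b t) ≡ isLeaf t
isLeaf-ψᵀ⁻¹ b leaf = refl
isLeaf-ψᵀ⁻¹ b (node l m r) with b ∧ exactlyOneLeaf l r
... | true  = refl
... | false = refl

ψᵀ⁻¹-ψᵀ : ∀ b t → ψᵀ⁻¹ b (ψᵀ b t) ≡ t
ψᵀ⁻¹-ψᵀ b leaf = refl
ψᵀ⁻¹-ψᵀ b (node l m r) with b ∧ exactlyOneLeaf l r in swapped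
... | true  rewrite isLeaf-ψᵀ (not b) r | isLeaf-ψᵀ b l | Bool.xor-comm (isLeaf r) (isLeaf l) | swapped
                  | ψᵀ⁻¹-ψᵀ b l | ψᵀ⁻¹-ψᵀ (not b) r = refl
... | false rewrite isLeaf-ψᵀ b l | isLeaf-ψᵀ (not b) r | swapped
                  | ψᵀ⁻¹-ψᵀ b l | ψᵀ⁻¹-ψᵀ (not b) r = refl

ψᵀ-ψᵀ⁻¹ : ∀ b t → ψᵀ b (ψᵀ⁻¹ b t) ≡ t
ψᵀ-ψᵀ⁻¹ b leaf = refl
ψᵀ-ψᵀ⁻¹ b (node l m r) with b ∧ exactlyOneLeaf l r in swapped
... | true  rewrite isLeaf-ψᵀ⁻¹ (not b) l | isLeaf-ψᵀ⁻¹ b r | Bool.xor-comm (isLeaf r) (isLeaf l) | swapped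
                  | ψᵀ-ψᵀ⁻¹ (not b) l | ψᵀ-ψᵀ⁻¹ b r = refl
... | false rewrite isLeaf-ψᵀ⁻¹ b l | isLeaf-ψᵀ⁻¹ (not b) r | swapped
                  | ψᵀ-ψᵀ⁻¹ b l | ψᵀ-ψᵀ⁻¹ (not b) r = refl

labels-ψᵀ⁻¹ : ∀ b t → labels (ψᵀ⁻¹ b t) ↭ labels t
labels-ψᵀ⁻¹ b leaf = ↭-refl
labels-ψᵀ⁻¹ b (node l m r) with b ∧ exactlyOneLeaf l r
... | true  = ↭-trans (++⁺ (labels-ψᵀ⁻¹ b r) (_↭_.prep m (labels-ψᵀ⁻¹ (not b) l)))
                      (labels-swapIf true (node l m r))
... | false = ++⁺ (labels-ψᵀ⁻¹ b l) (_↭_.prep m (labels-ψᵀ⁻¹ (not b) r))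

Decreasing-ψᵀ⁻¹ : ∀ b {t} → Decreasing t → Decreasing (ψᵀ⁻¹ b t)
Decreasing-ψᵀ⁻¹ b leaf = leaf
Decreasing-ψᵀ⁻¹ b {node l m r} (node l<m r<m dl dr) with b ∧ exactlyOneLeaf l r
... | true  = node (All-resp-↭ (↭-sym (labels-ψᵀ⁻¹ b r)) r<m)
                   (All-resp-↭ (↭-sym (labels-ψᵀ⁻¹ (not b) l)) l<m)
                   (Decreasing-ψᵀ⁻¹ b dr) (Decreasing-ψᵀ⁻¹ (not b) dl)
... | false = node (All-resp-↭ (↭-sym (labels-ψᵀ⁻¹ b l)) l<m)
                   (All-resp-↭ (↭-sym (labels-ψᵀ⁻¹ (not b) r)) r<m)
                   (Decreasing-ψᵀ⁻¹ b dl) (Decreasing-ψᵀ⁻¹ (not b) dr)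

-- Descents and veh

nonLeaf : BTree → ℕ
nonLeaf leaf         = 0
nonLeaf (node _ _ _) = 1

#rightChildren : BTree → ℕ
#rightChildren leaf         = 0
#rightChildren (node l m r) = #rightChildren l + (nonLeaf r + #rightChildren r)

mutual
  #evenRight : BTree → ℕ
  #evenRight leaf         = 0
  #evenRight (node l m r) = #evenRight l + suc (#oddRight r)

  #oddRight : BTree → ℕ
  #oddRight leaf         = 0
  #oddRight (node l m r) = #oddRight l + #evenRight r

des-++-∷ : ∀ {m} xs ys → All (_< m) xs → des (xs ++ m ∷ ys) ≡ des xs + des (m ∷ ys)
des-++-∷ []           ys []                 = refl
des-++-∷ (x ∷ [])     ys (x<m ∷ [])         rewrite ≮⇒<ᵇ≡false (<⇒≯ x<m) = refl
des-++-∷ (x ∷ y ∷ xs) ys (_ ∷ yxs<m) rewrite des-++-∷ (y ∷ xs) ys yxs<m =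
  sym (+-assoc (if y <ᵇ x then 1 else 0) (des (y ∷ xs)) _)

des-∷ : ∀ {m} t → All (_< m) (labels t) → des (m ∷ labels t) ≡ nonLeaf t + des (labels t)
des-∷     leaf         _   = refl
des-∷ {m} (node l x r) t<m = descent (labels l) t<m
  where
  descent : ∀ xs → All (_< m) (xs ++ x ∷ labels r) →
            des (m ∷ xs ++ x ∷ labels r) ≡ 1 + des (xs ++ x ∷ labels r)
  descent []      (x<m ∷ _) rewrite <⇒<ᵇ≡true x<m = refl
  descent (_ ∷ _) (y<m ∷ _) rewrite <⇒<ᵇ≡true y<m = refl

des-labels : ∀ {t} → Decreasing t → des (labels t) ≡ #rightChildren t
des-labels leaf = refl
des-labels {node l m r} (node l<m r<m dl dr) = begin
  des (labels l ++ m ∷ labels r)                ≡⟨ des-++-∷ (labels l) (labels r) l<m ⟩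
  des (labels l) + des (m ∷ labels r)           ≡⟨ cong (des (labels l) +_) (des-∷ r r<m) ⟩
  des (labels l) + (nonLeaf r + des (labels r))
    ≡⟨ cong₂ (λ a b → a + (nonLeaf r + b)) (des-labels dl) (des-labels dr) ⟩
  #rightChildren (node l m r)                   ∎

nonLeaf-ψᵀ : ∀ b t → nonLeaf (ψᵀ b t) ≡ nonLeaf t
nonLeaf-ψᵀ b leaf = refl
nonLeaf-ψᵀ b (node l m r) with b ∧ exactlyOneLeaf l r
... | true  = refl
... | false = refl

nonLeaf-balanced : ∀ l r → exactlyOneLeaf l r ≡ false → nonLeaf l ≡ nonLeaf r
nonLeaf-balanced leaf         leaf         _ = refl
nonLeaf-balanced (node _ _ _) (node _ _ _) _ = refl

mutual
  #rightChildren-ψᵀ-even : ∀ t → #rightChildren (ψᵀ false t) ≡ #oddRight t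
  #rightChildren-ψᵀ-even leaf         = refl
  #rightChildren-ψᵀ-even (node l m r) = cong₂ _+_ (#rightChildren-ψᵀ-even l) (begin
    nonLeaf (ψᵀ true r) + #rightChildren (ψᵀ true r)
      ≡⟨ +-comm (nonLeaf (ψᵀ true r)) _ ⟩
    #rightChildren (ψᵀ true r) + nonLeaf (ψᵀ true r)
      ≡⟨ cong (#rightChildren (ψᵀ true r) +_) (nonLeaf-ψᵀ true r) ⟩
    #rightChildren (ψᵀ true r) + nonLeaf r
      ≡⟨ #rightChildren-ψᵀ-odd r ⟩
    #evenRight r ∎)

  #rightChildren-ψᵀ-odd : ∀ t → #rightChildren (ψᵀ true t) + nonLeaf t ≡ #evenRight t
  #rightChildren-ψᵀ-odd leaf = refl
  #rightChildren-ψᵀ-odd (node l m r) with exactlyOneLeaf l r in oneLeaf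
  ... | true  = begin
    #rightChildren (ψᵀ false r) + (nonLeaf (ψᵀ true l) + #rightChildren (ψᵀ true l)) + 1
      ≡⟨ cong₂ (λ a b → a + (b + #rightChildren (ψᵀ true l)) + 1)
               (#rightChildren-ψᵀ-even r) (nonLeaf-ψᵀ true l) ⟩
    #oddRight r + (nonLeaf l + #rightChildren (ψᵀ true l)) + 1
      ≡⟨ rearrange (#oddRight r) (nonLeaf l) (#rightChildren (ψᵀ true l)) ⟩
    (#rightChildren (ψᵀ true l) + nonLeaf l) + suc (#oddRight r)
      ≡⟨ cong (_+ suc (#oddRight r)) (#rightChildren-ψᵀ-odd l) ⟩
    #evenRight l + suc (#oddRight r) ∎
    where
    rearrange : ∀ a x y → a + (x + y) + 1 ≡ (y + x) + suc a
    rearrange = solve-∀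
  ... | false = begin
    #rightChildren (ψᵀ true l) + (nonLeaf (ψᵀ false r) + #rightChildren (ψᵀ false r)) + 1
      ≡⟨ cong₂ (λ a b → #rightChildren (ψᵀ true l) + (a + b) + 1)
               (trans (nonLeaf-ψᵀ false r) (sym (nonLeaf-balanced l r oneLeaf))) (#rightChildren-ψᵀ-even r) ⟩
    #rightChildren (ψᵀ true l) + (nonLeaf l + #oddRight r) + 1
      ≡⟨ rearrange (#rightChildren (ψᵀ true l)) (nonLeaf l) (#oddRight r) ⟩
    (#rightChildren (ψᵀ true l) + nonLeaf l) + suc (#oddRight r)
      ≡⟨ cong (_+ suc (#oddRight r)) (#rightChildren-ψᵀ-odd l) ⟩
    #evenRight l + suc (#oddRight r) ∎
    where
    rearrange : ∀ y x a → y + (x + a) + 1 ≡ (y + x) + suc a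
    rearrange = solve-∀

module _ {P : ℕ → Set} (P? : Decidable P) where

  takeWhile-++-¬ : ∀ xs {y ys} → ¬ P y → takeWhile P? (xs ++ y ∷ ys) ≡ takeWhile P? xs
  takeWhile-++-¬ []       {y} ¬Py rewrite dec-false (P? y) ¬Py = refl
  takeWhile-++-¬ (x ∷ xs)     ¬Py with does (P? x)
  ... | true  = cong (x ∷_) (takeWhile-++-¬ xs ¬Py)
  ... | false = refl

  dropWhile-++-¬ : ∀ xs {y ys} → ¬ P y → dropWhile P? (xs ++ y ∷ ys) ≡ dropWhile P? xs ++ y ∷ ys
  dropWhile-++-¬ []       {y} ¬Py rewrite dec-false (P? y) ¬Py = refl
  dropWhile-++-¬ (x ∷ xs)     ¬Py with does (P? x)
  ... | true  = dropWhile-++-¬ xs ¬Py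
  ... | false = refl

  length-dropWhile : ∀ xs → length (dropWhile P? xs) ≤ length xs
  length-dropWhile []       = z≤n
  length-dropWhile (x ∷ xs) with does (P? x)
  ... | true  = m≤n⇒m≤1+n (length-dropWhile xs)
  ... | false = ≤-refl

blocks-[] : ∀ j → blocks j [] ≡ []
blocks-[] zero    = refl
blocks-[] (suc j) = refl

blocks-++ : ∀ j {m} xs R → All (_< m) xs → All (_< m) R → length xs < j →
            blocks j (xs ++ m ∷ R) ≡ blocks j xs ++ (m , R) ∷ []
blocks-++ (suc j) {m} [] R [] R<m _
  rewrite All.all⇒takeWhile≗id (_<? m) R<m | All.all⇒dropWhile≡[] (_<? m) R<m | blocks-[] j = refl
blocks-++ (suc j) {m} (a ∷ xs) R (a<m ∷ xs<m) R<m (s≤s len<j) = begin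
  (a , takeWhile (_<? a) (xs ++ m ∷ R)) ∷ blocks j (dropWhile (_<? a) (xs ++ m ∷ R))
    ≡⟨ cong₂ (λ T D → (a , T) ∷ blocks j D) (takeWhile-++-¬ (_<? a) xs m≮a) (dropWhile-++-¬ (_<? a) xs m≮a) ⟩
  (a , takeWhile (_<? a) xs) ∷ blocks j (dropWhile (_<? a) xs ++ m ∷ R)
    ≡⟨ cong ((a , takeWhile (_<? a) xs) ∷_)
            (blocks-++ j (dropWhile (_<? a) xs) R (All.dropWhile⁺ (_<? a) xs<m) R<m
                       (≤-<-trans (length-dropWhile (_<? a) xs) len<j)) ⟩
  (a , takeWhile (_<? a) xs) ∷ blocks j (dropWhile (_<? a) xs) ++ (m , R) ∷ [] ∎
  where
  m≮a : m ≮ a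
  m≮a = <⇒≯ a<m

buildRs-++ : ∀ k xs ys → buildRs k (xs ++ ys) ≡ buildRs k xs ++ buildRs k ys
buildRs-++ k []             ys = refl
buildRs-++ k ((m , w) ∷ xs) ys = cong (buildR k (just m) w ∷_) (buildRs-++ k xs ys)

odL-++ : ∀ xs ys → odL (xs ++ ys) ≡ odL xs + odL ys
odL-++ []       ys = refl
odL-++ (x ∷ xs) ys rewrite odL-++ xs ys = sym (+-assoc (od x) (odL xs) (odL ys))

evL-++ : ∀ xs ys → evL (xs ++ ys) ≡ evL xs + evL ys
evL-++ []       ys = refl
evL-++ (x ∷ xs) ys rewrite evL-++ xs ys = sym (+-assoc (ev x) (evL xs) (evL ys))

-- The subtrees of the root of T(labels t; m): a right edge of t leads one level
-- down in T, a left edge stays on the same level.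
forest : BTree → List Rose
forest leaf         = []
forest (node l m r) = forest l ++ rose (just m) (forest r) ∷ []

buildRs-blocks : ∀ k j {t} → Decreasing t → size t ≤ k → size t ≤ j →
                 buildRs k (blocks j (labels t)) ≡ forest t
buildRs-blocks k       j leaf _ _ = cong (buildRs k) (blocks-[] j)
buildRs-blocks zero    j {node l m r} _ size≤0 _ with () ← subst (_≤ 0) (size-node l m r) size≤0
buildRs-blocks (suc k) j {node l m r} (node l<m r<m dl dr) size≤k size≤j = begin
  buildRs (suc k) (blocks j (labels l ++ m ∷ labels r))
    ≡⟨ cong (buildRs (suc k)) (blocks-++ j (labels l) (labels r) l<m r<m size[l]<j) ⟩
  buildRs (suc k) (blocks j (labels l) ++ (m , labels r) ∷ [])
    ≡⟨ buildRs-++ (suc k) (blocks j (labels l)) _ ⟩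
  buildRs (suc k) (blocks j (labels l)) ++ rose (just m) (buildRs k (blocks (size r) (labels r))) ∷ []
    ≡⟨ cong₂ (λ F R → F ++ rose (just m) R ∷ [])
             (buildRs-blocks (suc k) j dl (m≤n⇒m≤1+n (m+n≤o⇒m≤o (size l) sizes≤k)) (<⇒≤ size[l]<j))
             (buildRs-blocks k (size r) dr (m+n≤o⇒n≤o (size l) sizes≤k) ≤-refl) ⟩
  forest (node l m r) ∎
  where
  sizes≤k : size l + size r ≤ k
  sizes≤k = s≤s⁻¹ (subst (_≤ suc k) (size-node l m r) size≤k)
  size[l]<j : size l < j
  size[l]<j = <-≤-trans (s≤s (m≤m+n (size l) (size r))) (subst (_≤ j) (size-node l m r) size≤j)

mutual
  odL-forest : ∀ t → odL (forest t) ≡ #oddRight t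
  odL-forest leaf         = refl
  odL-forest (node l m r) = begin
    odL (forest l ++ rose (just m) (forest r) ∷ [])
      ≡⟨ odL-++ (forest l) _ ⟩
    odL (forest l) + (evL (forest r) + 0)
      ≡⟨ cong₂ _+_ (odL-forest l) (trans (+-identityʳ _) (evL-forest r)) ⟩
    #oddRight l + #evenRight r ∎

  evL-forest : ∀ t → evL (forest t) ≡ #evenRight t
  evL-forest leaf         = refl
  evL-forest (node l m r) = begin
    evL (forest l ++ rose (just m) (forest r) ∷ [])
      ≡⟨ evL-++ (forest l) _ ⟩
    evL (forest l) + (suc (odL (forest r)) + 0)
      ≡⟨ cong₂ _+_ (evL-forest l) (trans (+-identityʳ _) (cong suc (odL-forest r))) ⟩
    #evenRight l + suc (#oddRight r) ∎

veh-labels : ∀ {t} → Decreasing t → veh (labels t) ≡ #oddRight t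
veh-labels {t} dt = begin
  odL (buildRs (size t) (blocks (size t) (labels t))) ≡⟨ cong odL (buildRs-blocks (size t) (size t) dt ≤-refl ≤-refl) ⟩
  odL (forest t)                                      ≡⟨ odL-forest t ⟩
  #oddRight t                                         ∎

-- Permutations

oneTo-Unique : ∀ n → Unique (oneTo n)
oneTo-Unique n = Unique.map⁺ suc-injective (Unique.upTo⁺ n)

oneTo-inRange : ∀ n → All (λ x → 1 ≤ x × x ≤ n) (oneTo n)
oneTo-inRange n = All.map⁺ (All.applyUpTo⁺₁ id n λ i<n → s≤s z≤n , i<n)

length-oneTo : ∀ n → length (oneTo n) ≡ n
length-oneTo n = trans (length-map suc (upTo n)) (length-upTo n)

IsPerm⇒Unique : ∀ {n π} → IsPerm n π → Unique π
IsPerm⇒Unique π∈𝔖 = Unique-resp-↭ (↭-sym π∈𝔖) (oneTo-Unique _)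

IsPerm⇒inRange : ∀ {n π} → IsPerm n π → All (λ x → 1 ≤ x × x ≤ n) π
IsPerm⇒inRange π∈𝔖 = All-resp-↭ (↭-sym π∈𝔖) (oneTo-inRange _)

IsPerm⇒WellLabelled : ∀ {n π} → IsPerm n π → WellLabelled (decTree π)
IsPerm⇒WellLabelled {n} {π} π∈𝔖 = wellLabelled
  (decTree-Decreasing π!)
  (subst Unique (sym labels≡) π!)
  (subst (λ w → All (_≤ length w) w) (sym labels≡) π≤length)
  where
  π! : Unique π
  π! = IsPerm⇒Unique π∈𝔖
  labels≡ : labels (decTree π) ≡ π
  labels≡ = labels-decTree π!
  π≤length : All (_≤ length π) π
  π≤length = subst (λ k → All (_≤ k) π) (sym (trans (↭-length π∈𝔖) (length-oneTo n)))
                   (All.map proj₂ (IsPerm⇒inRange π∈𝔖))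

Decreasing-ψᵀ : ∀ b {t} → WellLabelled t → Decreasing (ψᵀ b t)
Decreasing-ψᵀ b (wellLabelled dt t! _) = subst Decreasing (swapAt-rEdges b dt t!) (Decreasing-swapAt _ dt)

Ψ′-labels : ∀ {n π} → IsPerm n π → Ψ′ π ≡ labels (ψᵀ false (decTree π))
Ψ′-labels {π = π} π∈𝔖 = begin
  φ′S (Odd π) π
    ≡⟨ cong (φ′S (Odd π)) (labels-decTree π!) ⟨
  φ′S (Odd π) (labels t)
    ≡⟨ φ′S-labels (Odd π) wl ⟩
  labels (swapAt (occursOddly (Odd π)) t)
    ≡⟨ cong labels (swapAt-cong t λ y∈t → occursOddly-Odd π! (subst (_ ∈_) (labels-decTree π!) y∈t)) ⟩
  labels (swapAt (λ y → isOdd (rEdges t y)) t)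
    ≡⟨ cong labels (swapAt-rEdges false (WellLabelled.decreasing wl) (WellLabelled.unique wl)) ⟩
  labels (ψᵀ false t) ∎
  where
  π! : Unique π
  π! = IsPerm⇒Unique π∈𝔖
  t : BTree
  t = decTree π
  wl : WellLabelled t
  wl = IsPerm⇒WellLabelled π∈𝔖

decTree-Ψ′ : ∀ {n π} → IsPerm n π → decTree (Ψ′ π) ≡ ψᵀ false (decTree π)
decTree-Ψ′ π∈𝔖 = trans (cong decTree (Ψ′-labels π∈𝔖))
                        (decTree-labels (Decreasing-ψᵀ false (IsPerm⇒WellLabelled π∈𝔖)))

Ψ′-injective : ∀ {n π σ} → IsPerm n π → IsPerm n σ → Ψ′ π ≡ Ψ′ σ → π ≡ σ
Ψ′-injective {π = π} {σ} π∈𝔖 σ∈𝔖 Ψ′π≡Ψ′σ = begin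
  π                                          ≡⟨ labels-decTree (IsPerm⇒Unique π∈𝔖) ⟨
  labels (decTree π)                         ≡⟨ cong labels (ψᵀ⁻¹-ψᵀ false (decTree π)) ⟨
  labels (ψᵀ⁻¹ false (ψᵀ false (decTree π))) ≡⟨ cong (labels ∘ ψᵀ⁻¹ false) (decTree-Ψ′ π∈𝔖) ⟨
  labels (ψᵀ⁻¹ false (decTree (Ψ′ π)))       ≡⟨ cong (labels ∘ ψᵀ⁻¹ false ∘ decTree) Ψ′π≡Ψ′σ ⟩
  labels (ψᵀ⁻¹ false (decTree (Ψ′ σ)))       ≡⟨ cong (labels ∘ ψᵀ⁻¹ false) (decTree-Ψ′ σ∈𝔖) ⟩
  labels (ψᵀ⁻¹ false (ψᵀ false (decTree σ))) ≡⟨ cong labels (ψᵀ⁻¹-ψᵀ false (decTree σ)) ⟩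
  labels (decTree σ)                         ≡⟨ labels-decTree (IsPerm⇒Unique σ∈𝔖) ⟩
  σ                                          ∎

Ψ′-surjective : ∀ {n σ} → IsPerm n σ → ∃ λ π → IsPerm n π × Ψ′ π ≡ σ
Ψ′-surjective {n} {σ} σ∈𝔖 = labels t , π∈𝔖 , Ψ′π≡σ
  where
  σ! : Unique σ
  σ! = IsPerm⇒Unique σ∈𝔖
  t : BTree
  t = ψᵀ⁻¹ false (decTree σ)
  π∈𝔖 : IsPerm n (labels t)
  π∈𝔖 = ↭-trans (labels-ψᵀ⁻¹ false (decTree σ)) (subst (_↭ oneTo n) (sym (labels-decTree σ!)) σ∈𝔖)
  Ψ′π≡σ : Ψ′ (labels t) ≡ σ
  Ψ′π≡σ = begin
    Ψ′ (labels t)                          ≡⟨ Ψ′-labels π∈𝔖 ⟩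
    labels (ψᵀ false (decTree (labels t)))
      ≡⟨ cong (labels ∘ ψᵀ false) (decTree-labels (Decreasing-ψᵀ⁻¹ false (decTree-Decreasing σ!))) ⟩
    labels (ψᵀ false t)                    ≡⟨ cong labels (ψᵀ-ψᵀ⁻¹ false (decTree σ)) ⟩
    labels (decTree σ)                     ≡⟨ labels-decTree σ! ⟩
    σ                                      ∎

φ′S-involutive : ∀ {n π} S → IsPerm n π → φ′S S (φ′S S π) ≡ π
φ′S-involutive {π = π} S π∈𝔖 = begin
  φ′S S (φ′S S π)                 ≡⟨ cong (φ′S S ∘ φ′S S) (labels-decTree π!) ⟨
  φ′S S (φ′S S (labels t))        ≡⟨ cong (φ′S S) (φ′S-labels S wl) ⟩
  φ′S S (labels (swapAt f t))     ≡⟨ φ′S-labels S (WellLabelled-swapAt f wl) ⟩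
  labels (swapAt f (swapAt f t))  ≡⟨ cong labels (swapAt-involutive f t) ⟩
  labels t                        ≡⟨ labels-decTree π! ⟩
  π                               ∎
  where
  π! : Unique π
  π! = IsPerm⇒Unique π∈𝔖
  t : BTree
  t = decTree π
  wl : WellLabelled t
  wl = IsPerm⇒WellLabelled π∈𝔖
  f : ℕ → Bool
  f = occursOddly S

veh≡des∘Ψ′ : ∀ {n π} → IsPerm n π → veh π ≡ des (Ψ′ π)
veh≡des∘Ψ′ {π = π} π∈𝔖 = begin
  veh π                       ≡⟨ cong veh (labels-decTree (IsPerm⇒Unique π∈𝔖)) ⟨
  veh (labels t)              ≡⟨ veh-labels (WellLabelled.decreasing wl) ⟩
  #oddRight t                 ≡⟨ #rightChildren-ψᵀ-even t ⟨
  #rightChildren (ψᵀ false t) ≡⟨ des-labels (Decreasing-ψᵀ false wl) ⟨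
  des (labels (ψᵀ false t))   ≡⟨ cong des (Ψ′-labels π∈𝔖) ⟨
  des (Ψ′ π)                  ∎
  where
  t : BTree
  t = decTree π
  wl : WellLabelled t
  wl = IsPerm⇒WellLabelled π∈𝔖

Invariant-Odd : ∀ {n T π σ} → Invariant n T → IsPerm n π → T σ → T (φ′S (Odd π) σ)
Invariant-Odd {π = π} inv π∈𝔖 Tσ =
  inv (Odd π) (Unique.filter⁺ _ (IsPerm⇒Unique π∈𝔖)) (All.filter⁺ _ (IsPerm⇒inRange π∈𝔖)) _ Tσ

theorem7p2 : (n : ℕ) (T : List ℕ → Set) →
    (∀ π → T π → IsPerm n π) →
    Invariant n T →
    ((∀ π → T π → T (Ψ′ π))
      × (∀ π σ → T π → T σ → Ψ′ π ≡ Ψ′ σ → π ≡ σ)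
      × (∀ σ → T σ → ∃ λ π → T π × Ψ′ π ≡ σ))
    × (∀ π → T π → veh π ≡ des (Ψ′ π))
theorem7p2 n T T⊆𝔖 inv = (closed , injective , surjective) , λ π Tπ → veh≡des∘Ψ′ (T⊆𝔖 π Tπ)
  where
  closed : ∀ π → T π → T (Ψ′ π)
  closed π Tπ = Invariant-Odd inv (T⊆𝔖 π Tπ) Tπ

  injective : ∀ π σ → T π → T σ → Ψ′ π ≡ Ψ′ σ → π ≡ σ
  injective π σ Tπ Tσ = Ψ′-injective (T⊆𝔖 π Tπ) (T⊆𝔖 σ Tσ)

  surjective : ∀ σ → T σ → ∃ λ π → T π × Ψ′ π ≡ σ
  surjective σ Tσ with π , π∈𝔖 , Ψ′π≡σ ← Ψ′-surjective (T⊆𝔖 σ Tσ) =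
    π , subst T (φ′S-involutive (Odd π) π∈𝔖) (Invariant-Odd inv π∈𝔖 (subst T (sym Ψ′π≡σ) Tσ)) ,
    Ψ′π≡σ
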